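{- Let $R=(V,A)$ be a connected digraph (request graph) for which a tree solution $\mathcal T$ exists. Let $W=(u_0,u_1,\dots,u_{k-1},u_k=u_0)$ be a closed walk of $R$ and $S=\{u_0,\dots,u_{k-1}\}$. Then $\mathcal T_\downarrow[S]$ is connected.
   Context: A temporal graph is a pair $\mathcal G=(V,\mathcal E)$ where $\mathcal E$ is a finite set of (distinct) temporal edges $(\{u,v\},t)$ with $u\neq v\in V$ and $t$ a positive integer. A journey from $u_0$ to $u_k$ is a sequence $(u_0,u_1,t_0),\dots,(u_{k-1},u_k,t_{k-1})$ with each $(\{u_i,u_{i+1}\},t_i)\in\mathcal E$ and $t_0<\dots<t_{k-1}$. The footprint $\mathcal G_\downarrow$ is the static undirected graph on $V$ with edge set $\{\{u,v\}:(\{u,v\},t)\in\mathcal E\text{ for some }t\}$. A temporal graph $\mathcal G$ on $V$ is a solution for request graph $R=(V,A)$ if for every arc $(u,v)\in A$ there is a journey from $u$ to $v$ in $\mathcal G$. For connected $R$ (connected meaning its underlying undirected graph is connected), a tree solution is a solution with exactly $n-1$ temporal edges ($n=|V|$), so that its footprint is a tree. A closed walk of a digraph is a sequence $(u_0,\dots,u_k)$, $k\geq1$, with $(u_i,u_{i+1})$ an arc for all $i$ and $u_k=u_0$. $G[S]$ denotes the subgraph induced by $S$. -}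

module Defs where

open import Data.Nat using (ℕ; zero; suc; _<_; _∸_)
open import Data.Fin using (Fin; zero; suc; inject₁; fromℕ)
open import Data.Product using (Σ; ∃; _×_; _,_)
open import Data.Sum using (_⊎_)
open import Data.List using (List; length)
open import Data.List.Membership.Propositional using (_∈_)
open import Data.List.Relation.Unary.AllPairs using (AllPairs)
open import Relation.Nullary using (¬_)
open import Relation.Binary.PropositionalEquality using (_≡_; _≢_)
open import Relation.Binary.Construct.Closure.ReflexiveTransitive using (Star)
open import Relation.Binary.Construct.Closure.Symmetric using (SymClosure)

Digraph : ℕ → Set₁
Digraph n = Fin n → Fin n → Set

Connected : ∀ {n} → Digraph n → Set
Connected {n} A = ∀ (x y : Fin n) → Star (SymClosure A) x y

record TEdge (n : ℕ) : Set where
  constructor tedge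
  field
    u v  : Fin n
    t    : ℕ
    u≢v  : u ≢ v
    t>0  : 0 < t
open TEdge public

SameTEdge : ∀ {n} → TEdge n → TEdge n → Set
SameTEdge e f = ((u e ≡ u f × v e ≡ v f) ⊎ (u e ≡ v f × v e ≡ u f)) × t e ≡ t f

record TemporalGraph (n : ℕ) : Set where
  constructor tgraph
  field
    edges    : List (TEdge n)
    distinct : AllPairs (λ e f → ¬ SameTEdge e f) edges
open TemporalGraph public

Joins : ∀ {n} → TEdge n → Fin n → Fin n → Set
Joins e x y = (u e ≡ x × v e ≡ y) ⊎ (u e ≡ y × v e ≡ x)

data JourneyAfter {n} (G : TemporalGraph n) : ℕ → Fin n → Fin n → Set where
  []  : ∀ {s x} → JourneyAfter G s x x
  _∷_ : ∀ {s x z y} → (e : Σ (TEdge n) λ e → e ∈ edges G × Joins e x z × s < t e)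
      → JourneyAfter G (t (Data.Product.proj₁ e)) z y → JourneyAfter G s x y

-- A journey from x to y (times are positive, so the bound 0 is vacuous).
Journey : ∀ {n} → TemporalGraph n → Fin n → Fin n → Set
Journey G x y = JourneyAfter G 0 x y

IsSolution : ∀ {n} → Digraph n → TemporalGraph n → Set
IsSolution A G = ∀ x y → A x y → Journey G x y

IsTreeSolution : ∀ {n} → Digraph n → TemporalGraph n → Set
IsTreeSolution {n} A G = IsSolution A G × length (edges G) ≡ n ∸ 1

Footprint : ∀ {n} → TemporalGraph n → Fin n → Fin n → Set
Footprint G x y = ∃ λ e → e ∈ edges G × Joins e x y

-- A closed walk (w 0, w 1, ..., w m, w 0) of length k = m + 1 ≥ 1.
IsClosedWalk : ∀ {n} → Digraph n → (m : ℕ) → (Fin (suc m) → Fin n) → Set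
IsClosedWalk A m w =
  (∀ (i : Fin m) → A (w (inject₁ i)) (w (suc i))) × A (w (fromℕ m)) (w zero)

InducedEdge : ∀ {n} → (Fin n → Set) → (Fin n → Fin n → Set) → Fin n → Fin n → Set
InducedEdge S E x y = S x × S y × E x y

InducedConnected : ∀ {n} → (Fin n → Set) → (Fin n → Fin n → Set) → Set
InducedConnected {n} S E = ∀ (x y : Fin n) → S x → S y → Star (InducedEdge S E) x y

{-# OPTIONS --safe #-}
module Submission where

-- Concatenating the journeys of the tree solution along the closed walk gives a
-- closed walk C in the footprint. A connected graph on n vertices has at least
-- n − 1 edges, so every edge of the footprint is a bridge and C crosses each of
-- its edges in both directions. If C visited a vertex x outside S, every arrival
-- at x would lie inside a journey and be followed by a strictly later departure,
-- whose reverse crossing is again an arrival at x: the edge times would increase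
-- forever. So C, and with it every walk between the w i along C, stays in S.

open import Defs
open import Data.Nat using (ℕ; zero; suc; _≤_; _<_; _∸_; z≤n; s≤s)
open import Data.Nat.Properties using (∸-monoʳ-<; 1+n≰n)
open import Data.Nat.Induction using (<-wellFounded)
open import Data.Fin using (Fin; zero; suc; inject₁; fromℕ)
open import Data.Fin.Properties using (any?; _≟_)
open import Data.Product using (Σ; ∃; ∃₂; _×_; _,_; proj₁; proj₂)
import Data.Product as Product
open import Data.Sum using (_⊎_; inj₁; inj₂; [_,_])
open import Data.Empty using (⊥-elim)
open import Data.List using (List; []; _∷_; _++_; length; map)
open import Data.List.Properties using (length-++-sucʳ)
open import Data.List.Extrema.Nat using (max; xs≤max)
open import Data.List.Membership.Propositional using (_∈_)
open import Data.List.Membership.Propositional.Properties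
  using (∈-∃++; ∈-++⁻; ∈-++⁺ˡ; ∈-++⁺ʳ; ∈-map⁺)
open import Data.List.Relation.Unary.Any using (here; there)
import Data.List.Relation.Unary.All as All
open import Data.List.Relation.Binary.Subset.Propositional using (_⊆_)
open import Data.List.Relation.Binary.Subset.Propositional.Properties using (⊆-reflexive-↭; ∷⁺ʳ)
open import Data.List.Relation.Binary.Permutation.Propositional.Properties using (shift)
open import Function using (_∘_)
open import Induction.WellFounded using (Acc; acc)
open import Relation.Nullary using (¬_)
open import Relation.Nullary.Decidable using (decidable-stable)
open import Relation.Unary using (Decidable)
open import Relation.Binary.PropositionalEquality using (_≡_; _≢_; refl; sym; trans; cong; subst)
open import Relation.Binary.Construct.Closure.ReflexiveTransitive
  using (Star; ε; _◅_; _◅◅_; reverse; kleisliStar; _>>=_)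
open import Relation.Binary.Construct.Closure.Symmetric using (SymClosure; fwd; bwd)

no-ascending-chain : ∀ {A : Set} (h : A → ℕ) (B : ℕ) {Q : A → Set} →
  (∀ {a} → Q a → h a ≤ B) → (∀ {a} → Q a → ∃ λ b → Q b × h a < h b) → ∀ {a} → ¬ Q a
no-ascending-chain h B {Q} bounded ascend {a} = go (<-wellFounded (B ∸ h a))
  where
  go : ∀ {a} → Acc _<_ (B ∸ h a) → ¬ Q a
  go (acc rs) qa with b , qb , ha<hb ← ascend qa = go (rs (∸-monoʳ-< ha<hb (bounded qb))) qb

xs++y∷ys⊆y∷xs++ys : ∀ {A : Set} (xs : List A) y ys → xs ++ y ∷ ys ⊆ y ∷ xs ++ ys
xs++y∷ys⊆y∷xs++ys xs y ys = ⊆-reflexive-↭ (shift y xs ys)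

module _ {V : Set} {R : V → V → Set} where

  prefix : ∀ m (w : Fin (suc m) → V) → (∀ i → R (w (inject₁ i)) (w (suc i))) →
           ∀ j → Star R (w zero) (w j)
  prefix _ _ _ zero = ε
  prefix (suc m) w r (suc j) = r zero ◅ prefix m (w ∘ suc) (r ∘ suc) j

  suffix : ∀ m (w : Fin (suc m) → V) → (∀ i → R (w (inject₁ i)) (w (suc i))) →
           ∀ j → Star R (w j) (w (fromℕ m))
  suffix zero _ _ zero = ε
  suffix (suc m) w r zero = r zero ◅ suffix m (w ∘ suc) (r ∘ suc) zero
  suffix (suc m) w r (suc j) = suffix m (w ∘ suc) (r ∘ suc) j

InducedEdge-sym : ∀ {n} {S : Fin n → Set} {E : Fin n → Fin n → Set} →
  (∀ {a b} → E a b → E b a) → ∀ {a b} → InducedEdge S E a b → InducedEdge S E b a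
InducedEdge-sym E-sym (Sa , Sb , ab) = Sb , Sa , E-sym ab

-- A multigraph is a list of edges of an arbitrary type X with an endpoint map;
-- loops and parallel edges are allowed, so contracting an edge stays in the class.

Links : ∀ {A : Set} → A × A → A → A → Set
Links p a b = (proj₁ p ≡ a × proj₂ p ≡ b) ⊎ (proj₁ p ≡ b × proj₂ p ≡ a)

module _ {A : Set} where

  Links-sym : ∀ {p : A × A} {a b} → Links p a b → Links p b a
  Links-sym (inj₁ (pa , pb)) = inj₂ (pa , pb)
  Links-sym (inj₂ (pb , pa)) = inj₁ (pb , pa)

  Links-unique : ∀ {p : A × A} {a b c d} → Links p a b → Links p c d →
                 (a ≡ c × b ≡ d) ⊎ (a ≡ d × b ≡ c)
  Links-unique (inj₁ (refl , refl)) (inj₁ (refl , refl)) = inj₁ (refl , refl)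
  Links-unique (inj₁ (refl , refl)) (inj₂ (refl , refl)) = inj₂ (refl , refl)
  Links-unique (inj₂ (refl , refl)) (inj₁ (refl , refl)) = inj₂ (refl , refl)
  Links-unique (inj₂ (refl , refl)) (inj₂ (refl , refl)) = inj₁ (refl , refl)

  Links-map : ∀ {B : Set} (f : A → B) {p a b} → Links p a b → Links (Product.map f f p) (f a) (f b)
  Links-map f (inj₁ (refl , refl)) = inj₁ (refl , refl)
  Links-map f (inj₂ (refl , refl)) = inj₂ (refl , refl)

  module _ {X : Set} (ends : X → A × A) where

    Adjacent : List X → A → A → Set
    Adjacent G a b = ∃ λ e → e ∈ G × Links (ends e) a b

    Adjacent-sym : ∀ {G a b} → Adjacent G a b → Adjacent G b a
    Adjacent-sym (e , e∈G , links) = e , e∈G , Links-sym links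

    Adjacent-remove⁻ : ∀ G₁ G₂ {e a b} → Adjacent (G₁ ++ e ∷ G₂) a b →
                       Adjacent (G₁ ++ G₂) a b ⊎ Links (ends e) a b
    Adjacent-remove⁻ G₁ G₂ (e′ , e′∈G , links) with xs++y∷ys⊆y∷xs++ys G₁ _ G₂ e′∈G
    ... | here refl = inj₂ links
    ... | there e′∈G′ = inj₁ (e′ , e′∈G′ , links)

IsConnected : ∀ {n} {X : Set} → (X → Fin n × Fin n) → List X → Set
IsConnected {n} ends G = ∀ (a b : Fin n) → Star (Adjacent ends G) a b

edge-leaving-zero : ∀ {k} {X : Set} {ends : X → Fin (suc k) × Fin (suc k)} {G y} →
  Star (Adjacent ends G) zero (suc y) → ∃ λ v → Adjacent ends G zero (suc v)
edge-leaving-zero (_◅_ {j = zero} _ path) = edge-leaving-zero path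
edge-leaving-zero (_◅_ {j = suc v} adj _) = v , adj

contract : ∀ {k} → Fin k → Fin (suc k) → Fin k
contract v zero = v
contract v (suc y) = y

contract-collapses : ∀ {k} {v : Fin k} {p : Fin (suc k) × Fin (suc k)} {a b} →
                     Links p zero (suc v) → Links p a b → contract v a ≡ contract v b
contract-collapses zv ab = [ collapse , sym ∘ collapse ] (Links-unique zv ab)
  where
  collapse : ∀ {k} {v : Fin k} {a b} → zero ≡ a × suc v ≡ b → contract v a ≡ contract v b
  collapse (refl , refl) = refl

-- Contracting an edge between zero and suc v removes one vertex and one edge
-- and keeps the graph connected.
connected⇒length≥ : ∀ k {X : Set} (ends : X → Fin (suc k) × Fin (suc k)) (G : List X) →
                    IsConnected ends G → k ≤ length G
connected⇒length≥ zero _ _ _ = z≤n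
connected⇒length≥ (suc k) {X} ends G connected
  with edge-leaving-zero (connected zero (suc zero))
... | v , e , e∈G , e-links with ∈-∃++ e∈G
... | G₁ , G₂ , refl = subst (suc k ≤_) (sym (length-++-sucʳ G₁ e G₂))
      (s≤s (connected⇒length≥ k ends′ (G₁ ++ G₂) connected′))
  where
  ends′ : X → Fin (suc k) × Fin (suc k)
  ends′ = Product.map (contract v) (contract v) ∘ ends
  step : ∀ {a b} → Adjacent ends (G₁ ++ e ∷ G₂) a b →
         Star (Adjacent ends′ (G₁ ++ G₂)) (contract v a) (contract v b)
  step adj with Adjacent-remove⁻ ends G₁ G₂ adj
  ... | inj₁ (e′ , e′∈G′ , links) = (e′ , e′∈G′ , Links-map (contract v) links) ◅ ε
  ... | inj₂ links = subst (Star _ _) (contract-collapses e-links links) ε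
  connected′ : IsConnected ends′ (G₁ ++ G₂)
  connected′ a b = kleisliStar (contract v) step (connected (suc a) (suc b))

tree-edge-is-bridge : ∀ {n} {X : Set} (ends : X → Fin n × Fin n) (G₁ G₂ : List X) {e} →
  IsConnected ends (G₁ ++ e ∷ G₂) → length (G₁ ++ e ∷ G₂) ≡ n ∸ 1 →
  ∀ {a b} → Links (ends e) a b → ¬ Star (Adjacent ends (G₁ ++ G₂)) a b
tree-edge-is-bridge {zero} _ _ _ _ _ {a = ()}
tree-edge-is-bridge {suc k} ends G₁ G₂ {e} connected size e-links path =
  1+n≰n (subst (_≤ length (G₁ ++ G₂)) (trans (sym size) (length-++-sucʳ G₁ e G₂))
          (connected⇒length≥ k ends (G₁ ++ G₂) connected′))
  where
  bypass : ∀ {x y} → Adjacent ends (G₁ ++ e ∷ G₂) x y → Star (Adjacent ends (G₁ ++ G₂)) x y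
  bypass adj with Adjacent-remove⁻ ends G₁ G₂ adj
  ... | inj₁ adj′ = adj′ ◅ ε
  ... | inj₂ links with Links-unique e-links links
  ...   | inj₁ (refl , refl) = path
  ...   | inj₂ (refl , refl) = reverse (Adjacent-sym ends) path
  connected′ : IsConnected ends (G₁ ++ G₂)
  connected′ a b = connected a b >>= bypass

-- The footprint of T is Adjacent endpoints (edges T), definitionally.
endpoints : ∀ {n} → TEdge n → Fin n × Fin n
endpoints e = u e , v e

module Walks {n : ℕ} (T : TemporalGraph n) where

  Walk : Fin n → Fin n → Set
  Walk = Star (Footprint T)

  Footprint-sym : ∀ {a b} → Footprint T a b → Footprint T b a
  Footprint-sym = Adjacent-sym endpoints

  Traversal : Set
  Traversal = Fin n × Fin n × TEdge n

  traversals : ∀ {p q} → Walk p q → List Traversal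
  traversals ε = []
  traversals (_◅_ {p} {z} (e , _) W) = (p , z , e) ∷ traversals W

  traversals-◅◅ : ∀ {p q r} (W : Walk p q) (K : Walk q r) →
                  traversals (W ◅◅ K) ≡ traversals W ++ traversals K
  traversals-◅◅ ε K = refl
  traversals-◅◅ (s ◅ W) K = cong (_ ∷_) (traversals-◅◅ W K)

  traversal-in-footprint : ∀ {p q a b e} (W : Walk p q) → (a , b , e) ∈ traversals W →
                           e ∈ edges T × Joins e a b
  traversal-in-footprint ((_ , e∈T , joins) ◅ _) (here refl) = e∈T , joins
  traversal-in-footprint (_ ◅ W) (there i) = traversal-in-footprint W i

  split-at : ∀ {p q a b e} (W : Walk p q) → (a , b , e) ∈ traversals W →
             Σ (Walk p a) λ W₁ → Σ (Walk b q) λ W₂ →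
             traversals W₁ ⊆ traversals W × traversals W₂ ⊆ traversals W
  split-at (_ ◅ W) (here refl) = ε , W , (λ ()) , there
  split-at (s ◅ W) (there i) with W₁ , W₂ , W₁⊆W , W₂⊆W ← split-at W i =
    s ◅ W₁ , W₂ , ∷⁺ʳ _ W₁⊆W , there ∘ W₂⊆W

  return-walk : ∀ {p a b e} (C : Walk p p) → (a , b , e) ∈ traversals C →
                Σ (Walk b a) λ K → traversals K ⊆ traversals C
  return-walk C i with W₁ , W₂ , W₁⊆C , W₂⊆C ← split-at C i =
    W₂ ◅◅ W₁ , [ W₂⊆C , W₁⊆C ] ∘ ∈-++⁻ (traversals W₂) ∘ subst (_ ∈_) (traversals-◅◅ W₂ W₁)

  must-cross : ∀ {f c x} {E′ : List (TEdge n)} → edges T ⊆ f ∷ E′ → Joins f c x →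
               ¬ Star (Adjacent endpoints E′) c x →
               ∀ {p q} (W : Walk p q) → Star (Adjacent endpoints E′) c p →
               Star (Adjacent endpoints E′) x q → (c , x , f) ∈ traversals W
  must-cross _ _ apart ε c~p x~q = ⊥-elim (apart (c~p ◅◅ reverse (Adjacent-sym endpoints) x~q))
  must-cross T⊆ joins apart ((e , e∈T , e-joins) ◅ W) c~p x~q with T⊆ e∈T
  ... | there e∈E′ = there (must-cross T⊆ joins apart W (c~p ◅◅ (e , e∈E′ , e-joins) ◅ ε) x~q)
  ... | here refl with Links-unique e-joins joins
  ...   | inj₁ (refl , refl) = here refl
  ...   | inj₂ (refl , _) = ⊥-elim (apart c~p)

  Reversible : List Traversal → Set
  Reversible P = ∀ {a b e} → (a , b , e) ∈ P → (b , a , e) ∈ P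

  closed-walk-reversible : IsConnected endpoints (edges T) → length (edges T) ≡ n ∸ 1 →
                           ∀ {p} (C : Walk p p) → Reversible (traversals C)
  closed-walk-reversible connected tree C {x} {c} {f} i
    with f∈T , joins ← traversal-in-footprint C i
    with E₁ , E₂ , T≡ ← ∈-∃++ f∈T
    with K , K⊆C ← return-walk C i
    = K⊆C (must-cross T⊆ (Links-sym joins) bridge K ε ε)
    where
    T⊆ : edges T ⊆ f ∷ E₁ ++ E₂
    T⊆ = xs++y∷ys⊆y∷xs++ys E₁ f E₂ ∘ subst (_ ∈_) T≡
    bridge : ¬ Star (Adjacent endpoints (E₁ ++ E₂)) c x
    bridge = tree-edge-is-bridge endpoints E₁ E₂
               (subst (IsConnected endpoints) T≡ connected)
               (subst (λ G → length G ≡ n ∸ 1) T≡ tree)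
               (Links-sym joins)

  ExitsLater : List Traversal → Fin n → Set
  ExitsLater P x = ∀ {a e} → (a , x , e) ∈ P → ∃₂ λ b f → (x , b , f) ∈ P × t e < t f

  ExitsLater-++ : ∀ {P Q x} → ExitsLater P x → ExitsLater Q x → ExitsLater (P ++ Q) x
  ExitsLater-++ {P} later-P later-Q i with ∈-++⁻ P i
  ... | inj₁ i-P with b , f , o , e<f ← later-P i-P = b , f , ∈-++⁺ˡ o , e<f
  ... | inj₂ i-Q with b , f , o , e<f ← later-Q i-Q = b , f , ∈-++⁺ʳ P o , e<f

  ExitsLater-◅◅ : ∀ {p q r x} (W : Walk p q) (K : Walk q r) → ExitsLater (traversals W) x →
                  ExitsLater (traversals K) x → ExitsLater (traversals (W ◅◅ K)) x
  ExitsLater-◅◅ W K later-W later-K rewrite traversals-◅◅ W K = ExitsLater-++ later-W later-K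

  walk : ∀ {s p q} → JourneyAfter T s p q → Walk p q
  walk [] = ε
  walk ((e , e∈T , joins , _) ∷ J) = (e , e∈T , joins) ◅ walk J

  journey-exits-later : ∀ {s p q x} (J : JourneyAfter T s p q) → x ≢ q →
                        ExitsLater (traversals (walk J)) x
  journey-exits-later (_ ∷ []) x≢q (here refl) = ⊥-elim (x≢q refl)
  journey-exits-later (_ ∷ (f , _ , _ , e<f) ∷ _) _ (here refl) = _ , f , there (here refl) , e<f
  journey-exits-later (_ ∷ J) x≢q (there i)
    with b , f , o , e<f ← journey-exits-later J x≢q i = b , f , there o , e<f

  latest : List Traversal → ℕ
  latest P = max 0 (map (t ∘ proj₂ ∘ proj₂) P)

  t≤latest : ∀ {P a b e} → (a , b , e) ∈ P → t e ≤ latest P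
  t≤latest {P} i = All.lookup (xs≤max 0 (map (t ∘ proj₂ ∘ proj₂) P)) (∈-map⁺ (t ∘ proj₂ ∘ proj₂) i)

  never-left : ∀ {P x} → Reversible P → ExitsLater P x → ∀ {b f} → ¬ (x , b , f) ∈ P
  never-left {P} {x} reversible later =
    no-ascending-chain (t ∘ proj₂) (latest P) {λ (b , f) → (x , b , f) ∈ P} t≤latest ascend
    where
    ascend : ∀ {bf} → (x , bf) ∈ P → ∃ λ bf′ → (x , bf′) ∈ P × t (proj₂ bf) < t (proj₂ bf′)
    ascend o with b′ , f′ , o′ , f<f′ ← later (reversible o) = (b′ , f′) , o′ , f<f′

  closed-walk-inside : IsConnected endpoints (edges T) → length (edges T) ≡ n ∸ 1 →
    ∀ {S : Fin n → Set} → Decidable S → ∀ {p} (C : Walk p p) →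
    (∀ {x} → ¬ S x → ExitsLater (traversals C) x) →
    ∀ {a b e} → (a , b , e) ∈ traversals C → S a × S b
  closed-walk-inside connected tree S? C later i =
      decidable-stable (S? _) (λ ¬Sa → never-left reversible (later ¬Sa) i)
    , decidable-stable (S? _) (λ ¬Sb → never-left reversible (later ¬Sb) (reversible i))
    where
    reversible : Reversible (traversals C)
    reversible = closed-walk-reversible connected tree C

  module _ {A : Digraph n} (solution : IsSolution A T) where

    footprint-connected : Connected A → IsConnected endpoints (edges T)
    footprint-connected connected a b = connected a b >>= arc-walk
      where
      arc-walk : ∀ {a b} → SymClosure A a b → Walk a b
      arc-walk (fwd r) = walk (solution _ _ r)
      arc-walk (bwd r) = reverse Footprint-sym (walk (solution _ _ r))

    module _ {S : Fin n → Set} where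

      route : ∀ {p q} → Star (InducedEdge S A) p q → Walk p q
      route Γ = Γ >>= λ (_ , _ , r) → walk (solution _ _ r)

      route-exits-later : ∀ {x} → ¬ S x → ∀ {p q} (Γ : Star (InducedEdge S A) p q) →
                          ExitsLater (traversals (route Γ)) x
      route-exits-later ¬Sx ε ()
      route-exits-later ¬Sx ((_ , Sq , r) ◅ Γ) =
        ExitsLater-◅◅ (walk (solution _ _ r)) (route Γ)
          (journey-exits-later (solution _ _ r) λ { refl → ¬Sx Sq })
          (route-exits-later ¬Sx Γ)

      inside-walk : ∀ {p q} (W : Walk p q) →
                    (∀ {a b e} → (a , b , e) ∈ traversals W → S a × S b) →
                    Star (InducedEdge S (Footprint T)) p q
      inside-walk ε _ = ε
      inside-walk (s ◅ W) inside =
        (proj₁ (inside (here refl)) , proj₂ (inside (here refl)) , s) ◅ inside-walk W (inside ∘ there)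

      closed-route-inside : Connected A → length (edges T) ≡ n ∸ 1 → Decidable S →
        ∀ {p q} (Γ : Star (InducedEdge S A) p q) → Star (InducedEdge S A) q p →
        Star (InducedEdge S (Footprint T)) p q
      closed-route-inside connected tree S? Γ Γ′ =
        inside-walk (route Γ)
          (closed-walk-inside (footprint-connected connected) tree S? C later
            ∘ subst (_ ∈_) (sym (traversals-◅◅ (route Γ) (route Γ′))) ∘ ∈-++⁺ˡ)
        where
        C : Walk _ _
        C = route Γ ◅◅ route Γ′
        later : ∀ {x} → ¬ S x → ExitsLater (traversals C) x
        later ¬Sx = ExitsLater-◅◅ (route Γ) (route Γ′)
                      (route-exits-later ¬Sx Γ) (route-exits-later ¬Sx Γ′)

open Walks

lemma4p1 : ∀ {n : ℕ} (A : Digraph n) (T : TemporalGraph n) →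
    Connected A → IsTreeSolution A T →
    (m : ℕ) (w : Fin (suc m) → Fin n) → IsClosedWalk A m w →
    InducedConnected (λ x → ∃ λ i → w i ≡ x) (Footprint T)
lemma4p1 A T connected (solution , tree) m w (arcs , closing) _ _ (i , refl) (j , refl) =
  reverse (InducedEdge-sym {S = S} (Footprint-sym T)) (from-start i) ◅◅ from-start j
  where
  S : Fin _ → Set
  S x = ∃ λ i → w i ≡ x
  arc : ∀ i → InducedEdge S A (w (inject₁ i)) (w (suc i))
  arc i = (inject₁ i , refl) , (suc i , refl) , arcs i
  from-start : ∀ j → Star (InducedEdge S (Footprint T)) (w zero) (w j)
  from-start j =
    closed-route-inside T solution connected tree (λ y → any? (λ i → w i ≟ y))
      (prefix m w arc j) (suffix m w arc j ◅◅ ((fromℕ m , refl) , (zero , refl) , closing) ◅ ε)
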